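{- Let $d\ge 1$ and $k\ge 0$ be integers, let $\Gamma$ be a finite simplicial complex, and let $\gamma$ be a nontrivial $k$-cycle in the $d$-clique complex $\Delta_d(\Gamma)$ (i.e. a $k$-cycle representing a nonzero class in $\tilde H_k(\Delta_d(\Gamma);\mathbb{Z})$). Then the simplicial complex $\Delta_d(\Gamma)(\operatorname{supp}(\gamma))$ has at least $(d+1)(k-d+1)+d+1$ faces of dimension $d-1$.
   Context: For a simplicial complex $X$ on vertex set $V$, the $d$-clique complex $\Delta_d(X)$ is the simplicial complex on $V$ whose faces are all $F\subseteq V$ all of whose $(d+1)$-subsets are faces of $X$. For a $k$-chain $C$ in a simplicial complex $\Delta$, $\operatorname{supp}(C)$ is the set of $k$-simplices having nonzero coefficient in $C$, and $\Delta(\operatorname{supp}(C))$ denotes the simplicial complex consisting of all faces of simplices in $\operatorname{supp}(C)$ (the downward closure). -}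

module Defs where

open import Data.Nat as ℕ using (ℕ; zero; suc; _<ᵇ_)
open import Data.Integer as ℤ using (ℤ; +_; -_; _+_; _*_; _^_)
open import Data.Bool using (Bool; true; false; if_then_else_)
open import Data.Fin using (Fin; toℕ) renaming (zero to fzero; suc to fsuc)
open import Data.Fin.Subset using (Subset; _⊆_; ∣_∣; _∪_; _∩_; ⁅_⁆)
open import Data.Vec using (lookup; tabulate)
open import Data.Product using (Σ; _×_; ∃)
open import Data.List using (List; length)
open import Data.List.Relation.Unary.All using (All)
open import Data.List.Relation.Unary.Unique.Propositional using (Unique)
open import Relation.Binary.PropositionalEquality using (_≡_; _≢_)
open import Data.Empty using (⊥)
open import Data.Fin.Subset using () renaming (⊥ to ∅) public

record SimplicialComplex (n : ℕ) : Set₁ where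
  field
    face       : Subset n → Set
    empty-face : face ∅
    down-closed : ∀ {σ τ} → σ ⊆ τ → face τ → face σ
open SimplicialComplex public

CliqueFace : {n : ℕ} → ℕ → SimplicialComplex n → Subset n → Set
CliqueFace d X F = ∀ S → S ⊆ F → ∣ S ∣ ≡ suc d → face X S

-- Integer chains: coefficient functions on subsets of Fin n.  A k-simplex is
-- a (k+1)-element subset, oriented by the natural order of Fin n.
Chain : ℕ → Set
Chain n = Subset n → ℤ

IsChainOf : {n : ℕ} → (Subset n → Set) → ℕ → Chain n → Set
IsChainOf P k c = ∀ σ → c σ ≢ + 0 → (∣ σ ∣ ≡ suc k) × P σ

sumFin : (n : ℕ) → (Fin n → ℤ) → ℤ
sumFin zero    f = + 0
sumFin (suc n) f = f fzero + sumFin n (λ i → f (fsuc i))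

below : {n : ℕ} → Fin n → Subset n
below v = tabulate (λ u → toℕ u <ᵇ toℕ v)

-- Simplicial boundary (with the augmentation in degree 0, i.e. the reduced
-- chain complex, the empty face being the unique (-1)-simplex):
-- (∂c)(τ) = Σ_{v ∉ τ} (-1)^{#{u ∈ τ : u < v}} c(τ ∪ {v}).
∂ : {n : ℕ} → Chain n → Chain n
∂ {n} c τ = sumFin n (λ v → if lookup τ v then + 0
                            else (ℤ.-1ℤ ^ ∣ τ ∩ below v ∣) * c (τ ∪ ⁅ v ⁆))

IsNontrivialCycle : {n : ℕ} → (Subset n → Set) → ℕ → Chain n → Set
IsNontrivialCycle P k γ =
  IsChainOf P k γ
  × (∀ τ → ∂ γ τ ≡ + 0)
  × ((β : Chain _) → IsChainOf P (suc k) β → (∀ τ → ∂ β τ ≡ γ τ) → ⊥)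

SuppClosureFace : {n : ℕ} → Chain n → Subset n → Set
SuppClosureFace γ σ = ∃ λ τ → (γ τ ≢ + 0) × (σ ⊆ τ)

-- "P has at least m faces of dimension j" : there is a duplicate-free list of
-- at least m faces of P, each of cardinality j+1.  Stated with an integer
-- bound m since the paper's bound may be negative.
HasAtLeastFacesOfSize : {n : ℕ} → (Subset n → Set) → ℕ → ℤ → Set
HasAtLeastFacesOfSize P s m =
  Σ (List (Subset _)) λ L → Unique L × All (λ σ → P σ × ∣ σ ∣ ≡ s) L × (m ℤ.≤ + length L)

module Submission where

-- Fix a vertex v of a simplex in the support of a nonzero k-cycle γ.  Then γ is its
-- deletion at v plus the cone over its link, and the link is a nonzero (k-1)-cycle.
-- Faces of Δ(supp γ) through v are cones over faces of the link; faces avoiding v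
-- include the faces of the link, or in the top size a simplex of γ avoiding v (which
-- exists since γ is a cycle).  By Pascal's rule Δ(supp γ) therefore has at least
-- C(k+2, j) faces of size j ≤ k+1, and C(k+2, d) ≥ (d+1)(k-d+1)+d+1 for 2 ≤ d ≤ k+1
-- (for larger d the bound is not positive).
--
-- For d = 1 the bound is 2k+2 vertices and the clique structure is needed.  Induct on
-- the vertex set W of γ.  Either the link of v bounds a chain η on the neighbourhood
-- N of v, and then deletion + η is a nontrivial cycle on W ∖ v; or the link is
-- nontrivial on N, so |N| ≥ 2k, and some vertex of W lies outside N ∪ {v} (otherwise
-- γ would bound the cone over its deletion), whence |W| ≥ |N| + 2.

open import Defs
open import Data.Nat using (ℕ; suc; _≥_)
open import Data.Integer using (+_; _+_; _-_; _*_)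

open import Data.Nat as ℕ using (zero; _≤_; _<_; z≤n; s≤s; _<ᵇ_; _≤?_)
import Data.Nat.Properties as ℕ
import Data.Bool.Properties as Bool
open import Data.Nat.Combinatorics using (_C_; nC1≡n; nCn≡1; nCk+nC[k+1]≡[n+1]C[k+1])
open import Data.Integer as ℤ using (ℤ; -_; 0ℤ; -1ℤ)
import Data.Integer.Properties as ℤ
open import Data.Integer.Tactic.RingSolver using (solve-∀)
open import Data.Bool using (Bool; true; false; if_then_else_; _∨_; _∧_; _≟_)
open import Data.Fin as Fin using (Fin; toℕ; zero; suc)
import Data.Fin.Properties as Fin
open import Data.Fin.Subset using (Subset; ∣_∣; _∪_; _∩_; ⁅_⁆) renaming (_⊆_ to _⊆ₛ_; _∈_ to _∈ₛ_; _-_ to _∖_)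
import Data.Fin.Subset.Properties as Subset
open import Data.Vec using ([]; _∷_; lookup; tabulate)
import Data.Vec.Properties as Vec
open import Data.Product using (_×_; ∃; ∃-syntax; _,_; proj₁; proj₂)
open import Data.Sum using (_⊎_; inj₁; inj₂)
open import Data.Empty using (⊥-elim) renaming (⊥ to Empty)
open import Relation.Nullary using (Dec; yes; no; does; ¬?; _×-dec_)
open import Relation.Nullary.Decidable using (decidable-stable)
open import Relation.Binary.PropositionalEquality
open import Function using (_∘′_; _$_)
open import Data.List as List using (List; map; _++_; length)
open import Data.List.Membership.Propositional using (_∈_)
import Data.List.Membership.Propositional.Properties as Membership
import Data.List.Properties as List
open import Data.List.Relation.Unary.All as All using (All)
import Data.List.Relation.Unary.All.Properties as All
open import Data.List.Relation.Unary.AllPairs using (AllPairs)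
open import Data.List.Relation.Unary.Unique.Propositional using (Unique)
import Data.List.Relation.Unary.Unique.Propositional.Properties as Unique

-- Finite sums

sumFin-cong : ∀ n {f g : Fin n → ℤ} → (∀ i → f i ≡ g i) → sumFin n f ≡ sumFin n g
sumFin-cong zero    f≗g = refl
sumFin-cong (suc n) f≗g = cong₂ _+_ (f≗g zero) (sumFin-cong n (λ i → f≗g (suc i)))

sumFin-+ : ∀ n (f g : Fin n → ℤ) → sumFin n (λ i → f i + g i) ≡ sumFin n f + sumFin n g
sumFin-+ zero    f g = refl
sumFin-+ (suc n) f g =
  trans (cong (_+_ (f zero + g zero)) (sumFin-+ n (λ i → f (suc i)) (λ i → g (suc i))))
        (interchange (f zero) (g zero) _ _)
  where
  interchange : ∀ a b c d → a + b + (c + d) ≡ a + c + (b + d)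
  interchange = solve-∀

sumFin-neg : ∀ n (f : Fin n → ℤ) → sumFin n (λ i → - f i) ≡ - sumFin n f
sumFin-neg zero    f = refl
sumFin-neg (suc n) f =
  trans (cong (_+_ (- f zero)) (sumFin-neg n (λ i → f (suc i))))
        (sym (ℤ.neg-distrib-+ (f zero) _))

sumFin-*ˡ : ∀ n c (f : Fin n → ℤ) → sumFin n (λ i → c * f i) ≡ c * sumFin n f
sumFin-*ˡ zero    c f = sym (ℤ.*-zeroʳ c)
sumFin-*ˡ (suc n) c f =
  trans (cong (_+_ (c * f zero)) (sumFin-*ˡ n c (λ i → f (suc i))))
        (sym (ℤ.*-distribˡ-+ c (f zero) _))

sumFin-neg-*ˡ : ∀ n c (f g : Fin n → ℤ) → (∀ i → f i ≡ - (c * g i)) → sumFin n f ≡ - (c * sumFin n g)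
sumFin-neg-*ˡ n c f g f≗-cg =
  trans (sumFin-cong n f≗-cg) (trans (sumFin-neg n (λ i → c * g i)) (cong -_ (sumFin-*ˡ n c g)))

sumFin-0 : ∀ n (f : Fin n → ℤ) → (∀ i → f i ≡ 0ℤ) → sumFin n f ≡ 0ℤ
sumFin-0 zero    f f≗0 = refl
sumFin-0 (suc n) f f≗0 = cong₂ _+_ (f≗0 zero) (sumFin-0 n (λ i → f (suc i)) (λ i → f≗0 (suc i)))

sumFin-single : ∀ n (f : Fin n → ℤ) v → (∀ i → i ≢ v → f i ≡ 0ℤ) → sumFin n f ≡ f v
sumFin-single (suc n) f zero f≗0 =
  trans (cong (_+_ (f zero)) (sumFin-0 n (λ i → f (suc i)) (λ i → f≗0 (suc i) (λ ()))))
        (ℤ.+-identityʳ (f zero))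
sumFin-single (suc n) f (suc v) f≗0 =
  trans (cong₂ _+_ (f≗0 zero (λ ()))
                   (sumFin-single n (λ i → f (suc i)) v (λ i i≢v → f≗0 (suc i) (i≢v ∘′ Fin.suc-injective))))
        (ℤ.+-identityˡ (f (suc v)))

-- Subsets, through their characteristic vectors

module _ {n : ℕ} where

  lookup-ext : (p q : Subset n) → (∀ i → lookup p i ≡ lookup q i) → p ≡ q
  lookup-ext p q p≗q = trans (sym (Vec.tabulate∘lookup p)) (trans (Vec.tabulate-cong p≗q) (Vec.tabulate∘lookup q))

  ∈⇒lookup : ∀ {x} {p : Subset n} → x ∈ₛ p → lookup p x ≡ true
  ∈⇒lookup = Vec.[]=⇒lookup

  lookup⇒∈ : ∀ {x} {p : Subset n} → lookup p x ≡ true → x ∈ₛ p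
  lookup⇒∈ {x} {p} = Vec.lookup⇒[]= x p

  ⊆-lookup : ∀ {p q : Subset n} → p ⊆ₛ q → ∀ x → lookup p x ≡ true → lookup q x ≡ true
  ⊆-lookup p⊆q x px = ∈⇒lookup (p⊆q (lookup⇒∈ px))

  lookup-⁅x⁆-self : (v : Fin n) → lookup ⁅ v ⁆ v ≡ true
  lookup-⁅x⁆-self v = ∈⇒lookup (Subset.x∈⁅x⁆ v)

  lookup-⁅x⁆-other : (v i : Fin n) → i ≢ v → lookup ⁅ v ⁆ i ≡ false
  lookup-⁅x⁆-other v i i≢v with lookup ⁅ v ⁆ i in eq
  ... | true  = ⊥-elim (i≢v (Subset.x∈⁅y⁆⇒x≡y v (lookup⇒∈ eq)))
  ... | false = refl

  lookup-insert-self : ∀ (τ : Subset n) v → lookup (τ ∪ ⁅ v ⁆) v ≡ true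
  lookup-insert-self τ v
    rewrite Vec.lookup-zipWith _∨_ v τ ⁅ v ⁆ | lookup-⁅x⁆-self v = Bool.∨-zeroʳ (lookup τ v)

  lookup-insert-other : ∀ (τ : Subset n) v i → i ≢ v → lookup (τ ∪ ⁅ v ⁆) i ≡ lookup τ i
  lookup-insert-other τ v i i≢v
    rewrite Vec.lookup-zipWith _∨_ i τ ⁅ v ⁆ | lookup-⁅x⁆-other v i i≢v = Bool.∨-identityʳ (lookup τ i)

lookup-remove-self : ∀ {n} (σ : Subset n) v → lookup (σ ∖ v) v ≡ false
lookup-remove-self (x ∷ σ) zero    = refl
lookup-remove-self (x ∷ σ) (suc v) = lookup-remove-self σ v

lookup-remove-other : ∀ {n} (σ : Subset n) v i → i ≢ v → lookup (σ ∖ v) i ≡ lookup σ i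
lookup-remove-other (x ∷ σ) zero    zero    i≢v = ⊥-elim (i≢v refl)
lookup-remove-other (x ∷ σ) zero    (suc i) i≢v = cong (λ p → lookup p i) (Subset.p─⊥≡p σ)
lookup-remove-other (x ∷ σ) (suc v) zero    i≢v = refl
lookup-remove-other (x ∷ σ) (suc v) (suc i) i≢v = lookup-remove-other σ v i (i≢v ∘′ cong suc)

∣p∣≡suc∣q∣ : ∀ {n} (p q : Subset n) u → (∀ i → i ≢ u → lookup p i ≡ lookup q i) →
             lookup p u ≡ true → lookup q u ≡ false → ∣ p ∣ ≡ suc ∣ q ∣
∣p∣≡suc∣q∣ (true ∷ p) (false ∷ q) zero p≗q refl refl =
  cong (suc ∘′ ∣_∣) (lookup-ext p q (λ i → p≗q (suc i) (λ ())))
∣p∣≡suc∣q∣ (x ∷ p) (y ∷ q) (suc u) p≗q pu qu with p≗q zero (λ ())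
∣p∣≡suc∣q∣ (true  ∷ p) (.true  ∷ q) (suc u) p≗q pu qu | refl =
  cong suc (∣p∣≡suc∣q∣ p q u (λ i i≢u → p≗q (suc i) (i≢u ∘′ Fin.suc-injective)) pu qu)
∣p∣≡suc∣q∣ (false ∷ p) (.false ∷ q) (suc u) p≗q pu qu | refl =
  ∣p∣≡suc∣q∣ p q u (λ i i≢u → p≗q (suc i) (i≢u ∘′ Fin.suc-injective)) pu qu

∣p∣≡suc⇒element : ∀ {n} (σ : Subset n) {k} → ∣ σ ∣ ≡ suc k → ∃ λ v → lookup σ v ≡ true
∣p∣≡suc⇒element (true  ∷ σ) _ = zero , refl
∣p∣≡suc⇒element (false ∷ σ) ∣σ∣≡1+k with ∣p∣≡suc⇒element σ ∣σ∣≡1+k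
... | v , σv = suc v , σv

true≢false : true ≢ false
true≢false ()

module _ {n : ℕ} where

  ∣p∣≡suc∣p∖x∣ : ∀ (p : Subset n) x → lookup p x ≡ true → ∣ p ∣ ≡ suc ∣ p ∖ x ∣
  ∣p∣≡suc∣p∖x∣ p x px =
    ∣p∣≡suc∣q∣ p (p ∖ x) x (λ i i≢x → sym (lookup-remove-other p x i i≢x)) px (lookup-remove-self p x)

  ∣τ∪⁅v⁆∣≡suc∣τ∣ : ∀ (τ : Subset n) v → lookup τ v ≡ false → ∣ τ ∪ ⁅ v ⁆ ∣ ≡ suc ∣ τ ∣
  ∣τ∪⁅v⁆∣≡suc∣τ∣ τ v τv =
    ∣p∣≡suc∣q∣ (τ ∪ ⁅ v ⁆) τ v (lookup-insert-other τ v) (lookup-insert-self τ v) τv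

  element⇒1≤∣p∣ : ∀ (p : Subset n) x → lookup p x ≡ true → 1 ≤ ∣ p ∣
  element⇒1≤∣p∣ p x px rewrite ∣p∣≡suc∣p∖x∣ p x px = s≤s z≤n

  ∣p∣≡1⇒element-unique : ∀ (p : Subset n) u x → ∣ p ∣ ≡ 1 → lookup p u ≡ true → lookup p x ≡ true → x ≡ u
  ∣p∣≡1⇒element-unique p u x ∣p∣≡1 pu px with x Fin.≟ u
  ... | yes x≡u = x≡u
  ... | no  x≢u =
    ⊥-elim (ℕ.1+n≰n (subst (1 ≤_) ∣p∖u∣≡0 (element⇒1≤∣p∣ (p ∖ u) x (trans (lookup-remove-other p u x x≢u) px))))
    where
    ∣p∖u∣≡0 : ∣ p ∖ u ∣ ≡ 0
    ∣p∖u∣≡0 = ℕ.suc-injective (trans (sym (∣p∣≡suc∣p∖x∣ p u pu)) ∣p∣≡1)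

  remove-insert : ∀ (τ : Subset n) v → lookup τ v ≡ false → (τ ∪ ⁅ v ⁆) ∖ v ≡ τ
  remove-insert τ v τv = lookup-ext _ τ pointwise
    where
    pointwise : ∀ i → lookup ((τ ∪ ⁅ v ⁆) ∖ v) i ≡ lookup τ i
    pointwise i with i Fin.≟ v
    ... | yes refl = trans (lookup-remove-self (τ ∪ ⁅ v ⁆) v) (sym τv)
    ... | no  i≢v  = trans (lookup-remove-other (τ ∪ ⁅ v ⁆) v i i≢v) (lookup-insert-other τ v i i≢v)

  insert-remove : ∀ (σ : Subset n) v → lookup σ v ≡ true → (σ ∖ v) ∪ ⁅ v ⁆ ≡ σ
  insert-remove σ v σv = lookup-ext _ σ pointwise
    where
    pointwise : ∀ i → lookup ((σ ∖ v) ∪ ⁅ v ⁆) i ≡ lookup σ i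
    pointwise i with i Fin.≟ v
    ... | yes refl = trans (lookup-insert-self (σ ∖ v) v) (sym σv)
    ... | no  i≢v  = trans (lookup-insert-other (σ ∖ v) v i i≢v) (lookup-remove-other σ v i i≢v)

  insert-comm : ∀ (τ : Subset n) v w → (τ ∪ ⁅ v ⁆) ∪ ⁅ w ⁆ ≡ (τ ∪ ⁅ w ⁆) ∪ ⁅ v ⁆
  insert-comm τ v w = trans (Subset.∪-assoc τ ⁅ v ⁆ ⁅ w ⁆)
                     (trans (cong (τ ∪_) (Subset.∪-comm ⁅ v ⁆ ⁅ w ⁆)) (sym (Subset.∪-assoc τ ⁅ w ⁆ ⁅ v ⁆)))

  remove-insert-other : ∀ (τ : Subset n) v w → w ≢ v → (τ ∪ ⁅ w ⁆) ∖ v ≡ (τ ∖ v) ∪ ⁅ w ⁆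
  remove-insert-other τ v w w≢v = lookup-ext _ _ pointwise
    where
    pointwise : ∀ i → lookup ((τ ∪ ⁅ w ⁆) ∖ v) i ≡ lookup ((τ ∖ v) ∪ ⁅ w ⁆) i
    pointwise i with i Fin.≟ v | i Fin.≟ w
    ... | yes refl | yes refl = ⊥-elim (w≢v refl)
    ... | yes refl | no  i≢w  = trans (lookup-remove-self (τ ∪ ⁅ w ⁆) v)
                                     (sym (trans (lookup-insert-other (τ ∖ v) w i i≢w) (lookup-remove-self τ v)))
    ... | no  i≢v  | yes refl = trans (lookup-remove-other (τ ∪ ⁅ w ⁆) v i i≢v)
                                     (trans (lookup-insert-self τ w) (sym (lookup-insert-self (τ ∖ v) w)))
    ... | no  i≢v  | no  i≢w  = trans (lookup-remove-other (τ ∪ ⁅ w ⁆) v i i≢v)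
                                 (trans (lookup-insert-other τ w i i≢w)
                                 (sym (trans (lookup-insert-other (τ ∖ v) w i i≢w) (lookup-remove-other τ v i i≢v))))

  insert-mono-⊆ : ∀ {p q : Subset n} v → p ⊆ₛ q → p ∪ ⁅ v ⁆ ⊆ₛ q ∪ ⁅ v ⁆
  insert-mono-⊆ {p} {q} v p⊆q {x} x∈p∪v with x Fin.≟ v
  ... | yes refl = lookup⇒∈ (lookup-insert-self q x)
  ... | no  x≢v  = lookup⇒∈ (trans (lookup-insert-other q v x x≢v)
                     (⊆-lookup p⊆q x (trans (sym (lookup-insert-other p v x x≢v)) (∈⇒lookup x∈p∪v))))

  ⊆-remove : ∀ {p q : Subset n} x → p ⊆ₛ q → lookup p x ≡ false → p ⊆ₛ q ∖ x
  ⊆-remove x p⊆q px {i} i∈p =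
    Subset.x∈p∧x≢y⇒x∈p-y (p⊆q i∈p) λ { refl → true≢false (trans (sym (∈⇒lookup i∈p)) px) }

-- Signs and the boundary operator

lookup-∩ : ∀ {n} (p q : Subset n) i → lookup (p ∩ q) i ≡ lookup p i ∧ lookup q i
lookup-∩ p q i = Vec.lookup-zipWith _∧_ i p q

lookup-below : ∀ {n} (w u : Fin n) → lookup (below w) u ≡ (toℕ u <ᵇ toℕ w)
lookup-below w = Vec.lookup∘tabulate (λ u → toℕ u <ᵇ toℕ w)

sign : ∀ {n} → Subset n → Fin n → ℤ
sign τ w = -1ℤ ℤ.^ ∣ τ ∩ below w ∣

negIf : Bool → ℤ → ℤ
negIf b x = if b then -1ℤ * x else x

sign-insert : ∀ {n} (τ : Subset n) u w → lookup τ u ≡ false →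
              sign (τ ∪ ⁅ u ⁆) w ≡ negIf (toℕ u <ᵇ toℕ w) (sign τ w)
sign-insert τ u w τu with toℕ u <ᵇ toℕ w in u<w
... | true  = cong (-1ℤ ℤ.^_) (∣p∣≡suc∣q∣ ((τ ∪ ⁅ u ⁆) ∩ below w) (τ ∩ below w) u agree-off-u
                 (trans (lookup-∩ (τ ∪ ⁅ u ⁆) (below w) u) (cong₂ _∧_ (lookup-insert-self τ u) (trans (lookup-below w u) u<w)))
                 (trans (lookup-∩ τ (below w) u) (cong (_∧ lookup (below w) u) τu)))
  where
  agree-off-u : ∀ i → i ≢ u → lookup ((τ ∪ ⁅ u ⁆) ∩ below w) i ≡ lookup (τ ∩ below w) i
  agree-off-u i i≢u rewrite lookup-∩ (τ ∪ ⁅ u ⁆) (below w) i | lookup-∩ τ (below w) i | lookup-insert-other τ u i i≢u = refl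
... | false = cong (λ p → -1ℤ ℤ.^ ∣ p ∣) (lookup-ext ((τ ∪ ⁅ u ⁆) ∩ below w) (τ ∩ below w) agree)
  where
  agree : ∀ i → lookup ((τ ∪ ⁅ u ⁆) ∩ below w) i ≡ lookup (τ ∩ below w) i
  agree i with i Fin.≟ u
  ... | no  i≢u rewrite lookup-∩ (τ ∪ ⁅ u ⁆) (below w) i | lookup-∩ τ (below w) i | lookup-insert-other τ u i i≢u = refl
  ... | yes refl = trans (outside-below (τ ∪ ⁅ i ⁆)) (sym (outside-below τ))
    where
    outside-below : ∀ p → lookup (p ∩ below w) i ≡ false
    outside-below p = trans (lookup-∩ p (below w) i)
                        (trans (cong (lookup p i ∧_) (trans (lookup-below w i) u<w)) (Bool.∧-zeroʳ (lookup p i)))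

Opposite : Bool → Bool → Set
Opposite p q = (p ≡ true × q ≡ false) ⊎ (p ≡ false × q ≡ true)

<ᵇ-opposite : ∀ {n} (v w : Fin n) → w ≢ v → Opposite (toℕ v <ᵇ toℕ w) (toℕ w <ᵇ toℕ v)
<ᵇ-opposite zero    zero    w≢v = ⊥-elim (w≢v refl)
<ᵇ-opposite zero    (suc w) w≢v = inj₁ (refl , refl)
<ᵇ-opposite (suc v) zero    w≢v = inj₂ (refl , refl)
<ᵇ-opposite (suc v) (suc w) w≢v = <ᵇ-opposite v w (w≢v ∘′ cong suc)

-- Inserting v and w in the two possible orders changes exactly one of the two signs.
negIf-opposite : ∀ {p q} a b x → Opposite p q → negIf p a * (negIf q b * x) ≡ - (b * (a * x))
negIf-opposite a b x (inj₁ (refl , refl)) = identity a b x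
  where identity : ∀ a b x → -1ℤ * a * (b * x) ≡ - (b * (a * x))
        identity = solve-∀
negIf-opposite a b x (inj₂ (refl , refl)) = identity a b x
  where identity : ∀ a b x → a * (-1ℤ * b * x) ≡ - (b * (a * x))
        identity = solve-∀

negIf-opposite-exchange : ∀ {p q} a b x → Opposite p q → a * (negIf q b * x) ≡ - (b * (negIf p a * x))
negIf-opposite-exchange a b x (inj₁ (refl , refl)) = identity a b x
  where identity : ∀ a b x → a * (b * x) ≡ - (b * (-1ℤ * a * x))
        identity = solve-∀
negIf-opposite-exchange a b x (inj₂ (refl , refl)) = identity a b x
  where identity : ∀ a b x → a * (-1ℤ * b * x) ≡ - (b * (a * x))
        identity = solve-∀

sign-involutive : ∀ {n} (τ : Subset n) w x → sign τ w * (sign τ w * x) ≡ x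
sign-involutive τ w x = go ∣ τ ∩ below w ∣
  where
  go : ∀ m → -1ℤ ℤ.^ m * (-1ℤ ℤ.^ m * x) ≡ x
  go zero    = trans (ℤ.*-identityˡ _) (ℤ.*-identityˡ x)
  go (suc m) = trans (square-neg (-1ℤ ℤ.^ m) x) (go m)
    where square-neg : ∀ a x → -1ℤ * a * (-1ℤ * a * x) ≡ a * (a * x)
          square-neg = solve-∀

x+y≢0 : ∀ x y → x + y ≢ 0ℤ → x ≢ 0ℤ ⊎ y ≢ 0ℤ
x+y≢0 x y x+y≢0 with x ℤ.≟ 0ℤ
... | no  x≢0  = inj₁ x≢0
... | yes refl = inj₂ (λ y≡0 → x+y≢0 (trans (ℤ.+-identityˡ y) y≡0))

x-y≢0 : ∀ x y → x - y ≢ 0ℤ → x ≢ 0ℤ ⊎ y ≢ 0ℤ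
x-y≢0 x y x-y≢0 with x+y≢0 x (- y) x-y≢0
... | inj₁ x≢0  = inj₁ x≢0
... | inj₂ -y≢0 = inj₂ (λ y≡0 → -y≢0 (cong -_ y≡0))

x+y≡0⇒x≡-y : ∀ {x y} → x + y ≡ 0ℤ → x ≡ - y
x+y≡0⇒x≡-y {x} {y} x+y≡0 = ℤ.i-j≡0⇒i≡j x (- y) (trans (cong (_+_ x) (ℤ.neg-involutive y)) x+y≡0)

neg-zero : ∀ c → 0ℤ ≡ - (c * 0ℤ)
neg-zero c = sym (cong -_ (ℤ.*-zeroʳ c))

sign*x≡0⇒x≡0 : ∀ {n} (τ : Subset n) w x → sign τ w * x ≡ 0ℤ → x ≡ 0ℤ
sign*x≡0⇒x≡0 τ w x s*x≡0 = trans (sym (sign-involutive τ w x)) (trans (cong (sign τ w *_) s*x≡0) (ℤ.*-zeroʳ (sign τ w)))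

module _ {n : ℕ} where

  -- ∂ c τ is definitionally sumFin n (∂-term c τ).
  ∂-term : Chain n → Subset n → Fin n → ℤ
  ∂-term c τ w = if lookup τ w then 0ℤ else sign τ w * c (τ ∪ ⁅ w ⁆)

  link : Fin n → Chain n → Chain n
  link v γ τ = ∂-term γ τ v

  deletion : Fin n → Chain n → Chain n
  deletion v γ σ = if lookup σ v then 0ℤ else γ σ

  cone : Fin n → Chain n → Chain n
  cone v η σ = if lookup σ v then sign (σ ∖ v) v * η (σ ∖ v) else 0ℤ

  ∂-cong : ∀ (c c′ : Chain n) → (∀ σ → c σ ≡ c′ σ) → ∀ τ → ∂ c τ ≡ ∂ c′ τ
  ∂-cong c c′ c≗c′ τ = sumFin-cong n pointwise
    where
    pointwise : ∀ w → ∂-term c τ w ≡ ∂-term c′ τ w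
    pointwise w with lookup τ w
    ... | true  = refl
    ... | false = cong (sign τ w *_) (c≗c′ (τ ∪ ⁅ w ⁆))

  ∂-+ : ∀ (a b : Chain n) τ → ∂ (λ σ → a σ + b σ) τ ≡ ∂ a τ + ∂ b τ
  ∂-+ a b τ = trans (sumFin-cong n pointwise) (sumFin-+ n (∂-term a τ) (∂-term b τ))
    where
    pointwise : ∀ w → ∂-term (λ σ → a σ + b σ) τ w ≡ ∂-term a τ w + ∂-term b τ w
    pointwise w with lookup τ w
    ... | true  = refl
    ... | false = ℤ.*-distribˡ-+ (sign τ w) (a (τ ∪ ⁅ w ⁆)) (b (τ ∪ ⁅ w ⁆))

  ∂-neg : ∀ (a : Chain n) τ → ∂ (λ σ → - a σ) τ ≡ - ∂ a τ
  ∂-neg a τ = trans (sumFin-cong n pointwise) (sumFin-neg n (∂-term a τ))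
    where
    pointwise : ∀ w → ∂-term (λ σ → - a σ) τ w ≡ - ∂-term a τ w
    pointwise w with lookup τ w
    ... | true  = refl
    ... | false = sym (ℤ.neg-distribʳ-* (sign τ w) (a (τ ∪ ⁅ w ⁆)))

  ∂-minus : ∀ (a b : Chain n) τ → ∂ (λ σ → a σ - b σ) τ ≡ ∂ a τ - ∂ b τ
  ∂-minus a b τ = trans (∂-+ a (λ σ → - b σ) τ) (cong (_+_ (∂ a τ)) (∂-neg b τ))

  ∂-zero : ∀ τ → ∂ {n} (λ _ → 0ℤ) τ ≡ 0ℤ
  ∂-zero τ = sumFin-0 n _ pointwise
    where
    pointwise : ∀ w → ∂-term (λ _ → 0ℤ) τ w ≡ 0ℤ
    pointwise w with lookup τ w
    ... | true  = refl
    ... | false = ℤ.*-zeroʳ (sign τ w)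

  deletion+cone-link : ∀ v γ σ → γ σ ≡ deletion v γ σ + cone v (link v γ) σ
  deletion+cone-link v γ σ with lookup σ v in σv
  ... | false = sym (ℤ.+-identityʳ (γ σ))
  ... | true rewrite lookup-remove-self σ v | insert-remove σ v σv =
        sym (trans (ℤ.+-identityˡ _) (sign-involutive (σ ∖ v) v (γ σ)))

  ∂-deletion+link : ∀ v γ τ → lookup τ v ≡ false → ∂ (deletion v γ) τ + link v γ τ ≡ ∂ γ τ
  ∂-deletion+link v γ τ τv =
    sym (trans (sumFin-cong n pointwise)
        (trans (sumFin-+ n (∂-term (deletion v γ) τ) (at-v (link v γ τ)))
               (cong (_+_ (∂ (deletion v γ) τ)) (sumFin-at-v (link v γ τ)))))
    where
    at-v : ℤ → Fin n → ℤ
    at-v x w = if does (w Fin.≟ v) then x else 0ℤ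
    sumFin-at-v : ∀ x → sumFin n (at-v x) ≡ x
    sumFin-at-v x = trans (sumFin-single n (at-v x) v off-v) at-v-self
      where
      off-v : ∀ i → i ≢ v → at-v x i ≡ 0ℤ
      off-v i i≢v with i Fin.≟ v
      ... | yes i≡v = ⊥-elim (i≢v i≡v)
      ... | no  _   = refl
      at-v-self : at-v x v ≡ x
      at-v-self with v Fin.≟ v
      ... | yes _   = refl
      ... | no  v≢v = ⊥-elim (v≢v refl)
    pointwise : ∀ w → ∂-term γ τ w ≡ ∂-term (deletion v γ) τ w + at-v (link v γ τ) w
    pointwise w with w Fin.≟ v
    ... | yes refl rewrite τv | lookup-insert-self τ w =
          sym (trans (cong (_+ sign τ w * γ (τ ∪ ⁅ w ⁆)) (ℤ.*-zeroʳ (sign τ w))) (ℤ.+-identityˡ _))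
    ... | no  w≢v with lookup τ w
    ...   | true  = refl
    ...   | false rewrite lookup-insert-other τ w v (w≢v ∘′ sym) | τv = sym (ℤ.+-identityʳ _)

  ∂-deletion-∋v : ∀ v γ τ → lookup τ v ≡ true → ∂ (deletion v γ) τ ≡ 0ℤ
  ∂-deletion-∋v v γ τ τv = sumFin-0 n _ pointwise
    where
    pointwise : ∀ w → ∂-term (deletion v γ) τ w ≡ 0ℤ
    pointwise w with lookup τ w in τw
    ... | true  = refl
    ... | false with w Fin.≟ v
    ...   | yes refl = ⊥-elim (true≢false (trans (sym τv) τw))
    ...   | no  w≢v rewrite lookup-insert-other τ w v (w≢v ∘′ sym) | τv = ℤ.*-zeroʳ (sign τ w)

  link-∋v : ∀ v γ τ → lookup τ v ≡ true → link v γ τ ≡ 0ℤ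
  link-∋v v γ τ τv rewrite τv = refl

  cone-∌v : ∀ v η τ → lookup τ v ≡ false → cone v η τ ≡ 0ℤ
  cone-∌v v η τ τv rewrite τv = refl

  cone-∋v : ∀ v η σ → lookup σ v ≡ true → cone v η σ ≡ sign (σ ∖ v) v * η (σ ∖ v)
  cone-∋v v η σ σv rewrite σv = refl

  cone-cong : ∀ v (η η′ : Chain n) → (∀ σ → lookup σ v ≡ false → η σ ≡ η′ σ) →
              ∀ τ → cone v η τ ≡ cone v η′ τ
  cone-cong v η η′ η≗η′ τ with lookup τ v
  ... | false = refl
  ... | true  = cong (sign (τ ∖ v) v *_) (η≗η′ (τ ∖ v) (lookup-remove-self τ v))

  cone-neg : ∀ v (η : Chain n) τ → cone v (λ ρ → - η ρ) τ ≡ - cone v η τ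
  cone-neg v η τ with lookup τ v
  ... | true  = sym (ℤ.neg-distribʳ-* (sign (τ ∖ v) v) (η (τ ∖ v)))
  ... | false = refl

  deletion≢0 : ∀ v (γ : Chain n) σ → deletion v γ σ ≢ 0ℤ → lookup σ v ≡ false × γ σ ≢ 0ℤ
  deletion≢0 v γ σ deletion≢0 with lookup σ v
  ... | true  = ⊥-elim (deletion≢0 refl)
  ... | false = refl , deletion≢0

  deletion-∋v : ∀ v (γ : Chain n) σ → lookup σ v ≡ true → deletion v γ σ ≡ 0ℤ
  deletion-∋v v γ σ σv rewrite σv = refl

  cone≢0 : ∀ v (η : Chain n) σ → cone v η σ ≢ 0ℤ → lookup σ v ≡ true × η (σ ∖ v) ≢ 0ℤ
  cone≢0 v η σ cone≢0 with lookup σ v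
  ... | false = ⊥-elim (cone≢0 refl)
  ... | true  = refl , λ η≡0 → cone≢0 (trans (cong (sign (σ ∖ v) v *_) η≡0) (ℤ.*-zeroʳ (sign (σ ∖ v) v)))

  ∂-term-cone : ∀ v η → (∀ σ → lookup σ v ≡ true → η σ ≡ 0ℤ) → ∀ τ → lookup τ v ≡ true →
                ∀ w → ∂-term (cone v η) τ w ≡ - (sign (τ ∖ v) v * ∂-term η (τ ∖ v) w)
  ∂-term-cone v η η∋v≡0 τ τv w with w Fin.≟ v
  ... | yes refl rewrite τv | lookup-remove-self τ w | insert-remove τ w τv | η∋v≡0 τ τv =
        trans (neg-zero (sign (τ ∖ w) w)) (cong (λ z → - (sign (τ ∖ w) w * z)) (sym (ℤ.*-zeroʳ (sign (τ ∖ w) w))))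
  ... | no  w≢v rewrite lookup-remove-other τ v w w≢v with lookup τ w in τw
  ...   | true  = neg-zero (sign (τ ∖ v) v)
  ...   | false = begin
      sign τ w * cone v η (τ ∪ ⁅ w ⁆)
        ≡⟨ cong (sign τ w *_) (trans (cone-∋v v η (τ ∪ ⁅ w ⁆) (trans (lookup-insert-other τ w v (w≢v ∘′ sym)) τv))
                                     (cong (λ ρ → sign ρ v * η ρ) (remove-insert-other τ v w w≢v))) ⟩
      sign τ w * (sign (d ∪ ⁅ w ⁆) v * η (d ∪ ⁅ w ⁆))
        ≡⟨ cong (λ z → z * (sign (d ∪ ⁅ w ⁆) v * η (d ∪ ⁅ w ⁆)))
             (trans (cong (λ ρ → sign ρ w) (sym (insert-remove τ v τv))) (sign-insert d v w (lookup-remove-self τ v))) ⟩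
      negIf (toℕ v <ᵇ toℕ w) (sign d w) * (sign (d ∪ ⁅ w ⁆) v * η (d ∪ ⁅ w ⁆))
        ≡⟨ cong (λ z → negIf (toℕ v <ᵇ toℕ w) (sign d w) * (z * η (d ∪ ⁅ w ⁆)))
             (sign-insert d w v (trans (lookup-remove-other τ v w w≢v) τw)) ⟩
      negIf (toℕ v <ᵇ toℕ w) (sign d w) * (negIf (toℕ w <ᵇ toℕ v) (sign d v) * η (d ∪ ⁅ w ⁆))
        ≡⟨ negIf-opposite (sign d w) (sign d v) (η (d ∪ ⁅ w ⁆)) (<ᵇ-opposite v w w≢v) ⟩
      - (sign d v * (sign d w * η (d ∪ ⁅ w ⁆))) ∎
    where
    open ≡-Reasoning
    d = τ ∖ v

  ∂-cone : ∀ v η → (∀ σ → lookup σ v ≡ true → η σ ≡ 0ℤ) →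
           ∀ τ → ∂ (cone v η) τ ≡ η τ - cone v (∂ η) τ
  ∂-cone v η η∋v≡0 τ with lookup τ v in τv
  ... | false = trans (sumFin-single n (∂-term (cone v η) τ) v off-v) (trans at-v (sym (ℤ.+-identityʳ (η τ))))
    where
    off-v : ∀ w → w ≢ v → ∂-term (cone v η) τ w ≡ 0ℤ
    off-v w w≢v with lookup τ w
    ... | true  = refl
    ... | false rewrite cone-∌v v η (τ ∪ ⁅ w ⁆) (trans (lookup-insert-other τ w v (w≢v ∘′ sym)) τv) =
          ℤ.*-zeroʳ (sign τ w)
    at-v : ∂-term (cone v η) τ v ≡ η τ
    at-v rewrite τv | cone-∋v v η (τ ∪ ⁅ v ⁆) (lookup-insert-self τ v) | remove-insert τ v τv = sign-involutive τ v (η τ)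
  ... | true = trans (sumFin-neg-*ˡ n (sign (τ ∖ v) v) _ _ (∂-term-cone v η η∋v≡0 τ τv))
                     (sym (trans (cong (_- (sign (τ ∖ v) v * ∂ η (τ ∖ v))) (η∋v≡0 τ τv)) (ℤ.+-identityˡ _)))

  ∂-link : ∀ v γ ρ → lookup ρ v ≡ false → ∂ (link v γ) ρ ≡ - (sign ρ v * ∂ γ (ρ ∪ ⁅ v ⁆))
  ∂-link v γ ρ ρv = sumFin-neg-*ˡ n (sign ρ v) (∂-term (link v γ) ρ) (∂-term γ (ρ ∪ ⁅ v ⁆)) pointwise
    where
    open ≡-Reasoning
    pointwise : ∀ w → ∂-term (link v γ) ρ w ≡ - (sign ρ v * ∂-term γ (ρ ∪ ⁅ v ⁆) w)
    pointwise w with w Fin.≟ v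
    ... | yes refl rewrite ρv | lookup-insert-self ρ w =
          trans (ℤ.*-zeroʳ (sign ρ w)) (neg-zero (sign ρ w))
    ... | no  w≢v rewrite lookup-insert-other ρ v w w≢v with lookup ρ w in ρw
    ...   | true  = neg-zero (sign ρ v)
    ...   | false rewrite lookup-insert-other ρ w v (w≢v ∘′ sym) | ρv = begin
        sign ρ w * (sign (ρ ∪ ⁅ w ⁆) v * γ ((ρ ∪ ⁅ w ⁆) ∪ ⁅ v ⁆))
          ≡⟨ cong (λ z → sign ρ w * (z * γ ((ρ ∪ ⁅ w ⁆) ∪ ⁅ v ⁆))) (sign-insert ρ w v ρw) ⟩
        sign ρ w * (negIf (toℕ w <ᵇ toℕ v) (sign ρ v) * γ ((ρ ∪ ⁅ w ⁆) ∪ ⁅ v ⁆))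
          ≡⟨ negIf-opposite-exchange (sign ρ w) (sign ρ v) _ (<ᵇ-opposite v w w≢v) ⟩
        - (sign ρ v * (negIf (toℕ v <ᵇ toℕ w) (sign ρ w) * γ ((ρ ∪ ⁅ w ⁆) ∪ ⁅ v ⁆)))
          ≡⟨ cong (λ z → - (sign ρ v * z)) (cong₂ _*_ (sym (sign-insert ρ v w ρv)) (cong γ (insert-comm ρ w v))) ⟩
        - (sign ρ v * (sign (ρ ∪ ⁅ v ⁆) w * γ ((ρ ∪ ⁅ v ⁆) ∪ ⁅ w ⁆))) ∎

  ∂-link-∋v : ∀ v γ ρ → lookup ρ v ≡ true → ∂ (link v γ) ρ ≡ 0ℤ
  ∂-link-∋v v γ ρ ρv = sumFin-0 n _ pointwise
    where
    pointwise : ∀ w → ∂-term (link v γ) ρ w ≡ 0ℤ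
    pointwise w with w Fin.≟ v
    ... | yes refl rewrite ρv = refl
    ... | no  w≢v with lookup ρ w
    ...   | true  = refl
    ...   | false rewrite link-∋v v γ (ρ ∪ ⁅ w ⁆) (trans (lookup-insert-other ρ w v (w≢v ∘′ sym)) ρv) =
            ℤ.*-zeroʳ (sign ρ w)

-- Cycles and their links

Cycle : ∀ {n} → Chain n → Set
Cycle γ = ∀ τ → ∂ γ τ ≡ 0ℤ

Homogeneous : ∀ {n} → ℕ → Chain n → Set
Homogeneous s γ = ∀ σ → γ σ ≢ 0ℤ → ∣ σ ∣ ≡ s

module _ {n : ℕ} where

  link-cycle : ∀ v (γ : Chain n) → Cycle γ → Cycle (link v γ)
  link-cycle v γ cyc ρ with lookup ρ v in ρv
  ... | true  = ∂-link-∋v v γ ρ ρv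
  ... | false = trans (∂-link v γ ρ ρv) (trans (cong (λ z → - (sign ρ v * z)) (cyc (ρ ∪ ⁅ v ⁆)))
                                              (sym (neg-zero (sign ρ v))))

  ∂-deletion+link≡0 : ∀ v (γ : Chain n) → Cycle γ → ∀ τ → ∂ (deletion v γ) τ + link v γ τ ≡ 0ℤ
  ∂-deletion+link≡0 v γ cyc τ = by-cases (lookup τ v) refl
    where
    by-cases : ∀ b → lookup τ v ≡ b → ∂ (deletion v γ) τ + link v γ τ ≡ 0ℤ
    by-cases false τv = trans (∂-deletion+link v γ τ τv) (cyc τ)
    by-cases true  τv = cong₂ _+_ (∂-deletion-∋v v γ τ τv) (link-∋v v γ τ τv)

  link≢0⇒∌v : ∀ v (γ : Chain n) τ → link v γ τ ≢ 0ℤ → lookup τ v ≡ false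
  link≢0⇒∌v v γ τ link≢0 with lookup τ v
  ... | true  = ⊥-elim (link≢0 refl)
  ... | false = refl

  link≢0⇒γ≢0 : ∀ v (γ : Chain n) τ → link v γ τ ≢ 0ℤ → γ (τ ∪ ⁅ v ⁆) ≢ 0ℤ
  link≢0⇒γ≢0 v γ τ link≢0 γ≡0 = link≢0 (link≡0 (link≢0⇒∌v v γ τ link≢0))
    where
    link≡0 : lookup τ v ≡ false → link v γ τ ≡ 0ℤ
    link≡0 τv rewrite τv = trans (cong (sign τ v *_) γ≡0) (ℤ.*-zeroʳ (sign τ v))

  link-homogeneous : ∀ v (γ : Chain n) s → Homogeneous (suc s) γ → Homogeneous s (link v γ)
  link-homogeneous v γ s hom τ link≢0 = ℕ.suc-injective
    (trans (sym (∣τ∪⁅v⁆∣≡suc∣τ∣ τ v (link≢0⇒∌v v γ τ link≢0))) (hom (τ ∪ ⁅ v ⁆) (link≢0⇒γ≢0 v γ τ link≢0)))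

  link≢0 : ∀ v (γ : Chain n) σ → lookup σ v ≡ true → γ σ ≢ 0ℤ → link v γ (σ ∖ v) ≢ 0ℤ
  link≢0 v γ σ σv γσ≢0 link≡0 rewrite lookup-remove-self σ v | insert-remove σ v σv =
    γσ≢0 (sign*x≡0⇒x≡0 (σ ∖ v) v (γ σ) link≡0)

  -- If γ vanished off the star of v, then deletion v γ = 0 and link v γ = - ∂ (deletion v γ) = 0.
  cycle-avoids : ∀ v (γ : Chain n) → Cycle γ → ∀ σ → lookup σ v ≡ true → γ σ ≢ 0ℤ →
                 ∃ λ σ′ → γ σ′ ≢ 0ℤ × lookup σ′ v ≡ false
  cycle-avoids v γ cyc σ σv γσ≢0 with Subset.anySubset? {n = n} avoids?
    where
    avoids? : ∀ σ′ → Dec (γ σ′ ≢ 0ℤ × lookup σ′ v ≡ false)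
    avoids? σ′ with γ σ′ ℤ.≟ 0ℤ | lookup σ′ v ≟ false
    ... | yes γσ′≡0 | _       = no (λ (γσ′≢0 , _) → γσ′≢0 γσ′≡0)
    ... | no  γσ′≢0 | yes σ′v = yes (γσ′≢0 , σ′v)
    ... | no  _     | no  σ′v = no (λ (_ , σ′v′) → σ′v σ′v′)
  ... | yes avoiding = avoiding
  ... | no  ¬avoiding = ⊥-elim (link≢0 v γ σ σv γσ≢0 link≡0)
    where
    deletion≡0 : ∀ σ′ → deletion v γ σ′ ≡ 0ℤ
    deletion≡0 σ′ with lookup σ′ v in σ′v
    ... | true  = refl
    ... | false with γ σ′ ℤ.≟ 0ℤ
    ...   | yes γσ′≡0 = γσ′≡0
    ...   | no  γσ′≢0 = ⊥-elim (¬avoiding (σ′ , γσ′≢0 , σ′v))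
    link≡0 : link v γ (σ ∖ v) ≡ 0ℤ
    link≡0 = trans (sym (ℤ.+-identityˡ _))
               (trans (cong (_+ link v γ (σ ∖ v)) (sym (trans (∂-cong _ _ deletion≡0 (σ ∖ v)) (∂-zero (σ ∖ v)))))
                      (∂-deletion+link≡0 v γ cyc (σ ∖ v)))

nontrivial⇒nonzero : ∀ {n} {P : Subset n → Set} {k} {γ : Chain n} → IsNontrivialCycle P k γ → ∃ λ σ → γ σ ≢ 0ℤ
nontrivial⇒nonzero {n} {γ = γ} (_ , _ , ¬boundary) with Subset.anySubset? {n = n} (λ σ → ¬? (γ σ ℤ.≟ 0ℤ))
... | yes nonzero  = nonzero
... | no  ¬nonzero =
  ⊥-elim (¬boundary (λ _ → 0ℤ) (λ σ 0≢0 → ⊥-elim (0≢0 refl)) (λ τ → trans (∂-zero τ) (sym (γ≡0 τ))))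
  where
  γ≡0 : ∀ τ → γ τ ≡ 0ℤ
  γ≡0 τ = decidable-stable (γ τ ℤ.≟ 0ℤ) (λ γτ≢0 → ¬nonzero (τ , γτ≢0))

module _ {n : ℕ} (c : Chain n) where

  incident? : ∀ u → Dec (∃ λ ρ → c ρ ≢ 0ℤ × lookup ρ u ≡ true)
  incident? u = Subset.anySubset? (λ ρ → ¬? (c ρ ℤ.≟ 0ℤ) ×-dec (lookup ρ u ≟ true))

  vertices : Subset n
  vertices = tabulate (λ u → does (incident? u))

  vertices-∋ : ∀ ρ u → c ρ ≢ 0ℤ → lookup ρ u ≡ true → lookup vertices u ≡ true
  vertices-∋ ρ u cρ≢0 ρu rewrite Vec.lookup∘tabulate (λ u → does (incident? u)) u with incident? u
  ... | yes _         = refl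
  ... | no  ¬incident = ⊥-elim (¬incident (ρ , cρ≢0 , ρu))

  vertices-∈ : ∀ u → lookup vertices u ≡ true → ∃ λ ρ → c ρ ≢ 0ℤ × lookup ρ u ≡ true
  vertices-∈ u u∈ rewrite Vec.lookup∘tabulate (λ u → does (incident? u)) u with incident? u
  ... | yes incident = incident
  ... | no  _        = ⊥-elim (true≢false (sym u∈))

-- Faces of the closure of the support of a cycle

FaceList : ∀ {n} → Chain n → ℕ → List (Subset n) → Set
FaceList γ s L = Unique L × All (λ σ → SuppClosureFace γ σ × ∣ σ ∣ ≡ s) L

FaceListAvoiding : ∀ {n} → Chain n → Fin n → ℕ → List (Subset n) → Set
FaceListAvoiding γ v s L = Unique L × All (λ σ → (SuppClosureFace γ σ × ∣ σ ∣ ≡ s) × lookup σ v ≡ false) L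

module _ {n : ℕ} where

  [∅]-faceList : ∀ {γ : Chain n} {σ} → γ σ ≢ 0ℤ → FaceList γ 0 List.[ ∅ ]
  [∅]-faceList {σ = σ} γσ≢0 =
    (All.[] AllPairs.∷ AllPairs.[]) , ((σ , γσ≢0 , Subset.⊥⊆) , Subset.∣⊥∣≡0 n) All.∷ All.[]

  link-face : ∀ v (γ : Chain n) σ → SuppClosureFace (link v γ) σ →
              SuppClosureFace γ σ × lookup σ v ≡ false × SuppClosureFace γ (σ ∪ ⁅ v ⁆)
  link-face v γ σ (τ , link≢0 , σ⊆τ) =
    (τ ∪ ⁅ v ⁆ , link≢0⇒γ≢0 v γ τ link≢0 , Subset.⊆-trans σ⊆τ (Subset.p⊆p∪q ⁅ v ⁆)) ,
    σv ,
    (τ ∪ ⁅ v ⁆ , link≢0⇒γ≢0 v γ τ link≢0 , insert-mono-⊆ v σ⊆τ)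
    where
    σv : lookup σ v ≡ false
    σv with lookup σ v in σv
    ... | false = refl
    ... | true  = ⊥-elim (true≢false (trans (sym (⊆-lookup σ⊆τ v σv)) (link≢0⇒∌v v γ τ link≢0)))

  link-faceList⇒avoiding : ∀ v (γ : Chain n) s L → FaceList (link v γ) s L → FaceListAvoiding γ v s L
  link-faceList⇒avoiding v γ s L (unique , faces) =
    unique ,
    All.map (λ {σ} (face , size) → (proj₁ (link-face v γ σ face) , size) , proj₁ (proj₂ (link-face v γ σ face))) faces

  faceList-++ : ∀ v (γ : Chain n) d L₁ L₂ → FaceList (link v γ) d L₁ → FaceListAvoiding γ v (suc d) L₂ →
                FaceList γ (suc d) (map (_∪ ⁅ v ⁆) L₁ ++ L₂)
  faceList-++ v γ d L₁ L₂ (unique₁ , faces₁) (unique₂ , faces₂) =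
    Unique.++⁺ (Unique.map⁻ (subst Unique (sym remove∘insert≡id) unique₁)) unique₂ disjoint ,
    All.++⁺ (All.map⁺ (All.map (λ {σ} → coned σ) faces₁)) (All.map proj₁ faces₂)
    where
    avoids : All (λ σ → lookup σ v ≡ false) L₁
    avoids = All.map (λ {σ} (face , _) → proj₁ (proj₂ (link-face v γ σ face))) faces₁
    remove∘insert≡id : map (_∖ v) (map (_∪ ⁅ v ⁆) L₁) ≡ L₁
    remove∘insert≡id = trans (sym (List.map-∘ L₁)) (List.map-id-local (All.map (λ {σ} → remove-insert σ v) avoids))
    disjoint : ∀ {σ} → σ ∈ map (_∪ ⁅ v ⁆) L₁ × σ ∈ L₂ → Empty
    disjoint (σ∈L₁ , σ∈L₂) with Membership.∈-map⁻ (_∪ ⁅ v ⁆) σ∈L₁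
    ... | ρ , _ , refl = true≢false (trans (sym (lookup-insert-self ρ v)) (proj₂ (All.lookup faces₂ σ∈L₂)))
    coned : ∀ σ → SuppClosureFace (link v γ) σ × ∣ σ ∣ ≡ d →
            SuppClosureFace γ (σ ∪ ⁅ v ⁆) × ∣ σ ∪ ⁅ v ⁆ ∣ ≡ suc d
    coned σ (face , size) = proj₂ (proj₂ (link-face v γ σ face)) ,
      trans (∣τ∪⁅v⁆∣≡suc∣τ∣ σ v (proj₁ (proj₂ (link-face v γ σ face)))) (cong suc size)

  faces-avoiding : ∀ s {γ : Chain n} → Homogeneous (suc s) γ → Cycle γ → ∀ {σ v} → lookup σ v ≡ true → γ σ ≢ 0ℤ →
                   (∀ {d} → d ≤ s → ∃[ L ] FaceList (link v γ) d L × suc s C d ≤ length L) →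
                   ∀ {d} → d ≤ s → ∃[ L ] FaceListAvoiding γ v (suc d) L × suc s C suc d ≤ length L
  faces-avoiding s {γ} hom cyc {σ} {v} σv γσ≢0 link-faces {d} d≤s with suc d ≤? s
  ... | yes d<s with link-faces d<s
  ...   | L , faces , bound = L , link-faceList⇒avoiding v γ (suc d) L faces , bound
  faces-avoiding s {γ} hom cyc {σ} {v} σv γσ≢0 link-faces {d} d≤s | no d≮s with cycle-avoids v γ cyc σ σv γσ≢0
  ...   | σ′ , γσ′≢0 , σ′v =
          List.[ σ′ ] , ((All.[] AllPairs.∷ AllPairs.[]) , (((σ′ , γσ′≢0 , Subset.⊆-refl) , size) , σ′v) All.∷ All.[]) ,
          ℕ.≤-reflexive top
    where
    d≡s : d ≡ s
    d≡s = ℕ.≤-antisym d≤s (ℕ.≤-pred (ℕ.≰⇒> d≮s))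
    size : ∣ σ′ ∣ ≡ suc d
    size = trans (hom σ′ γσ′≢0) (cong suc (sym d≡s))
    top : suc s C suc d ≡ 1
    top = trans (cong (λ d → suc s C suc d) d≡s) (nCn≡1 (suc s))

  nonzero-cycle-faces : ∀ s {γ : Chain n} → Homogeneous s γ → Cycle γ → ∀ {σ} → γ σ ≢ 0ℤ →
                        ∀ {d} → d ≤ s → ∃[ L ] FaceList γ d L × suc s C d ≤ length L
  nonzero-cycle-faces s hom cyc γσ≢0 {zero} _ = _ , [∅]-faceList γσ≢0 , ℕ.≤-refl
  nonzero-cycle-faces (suc s) {γ} hom cyc {σ} γσ≢0 {suc d} (s≤s d≤s) with ∣p∣≡suc⇒element σ (hom σ γσ≢0)
  ... | v , σv with link-faces d≤s | faces-avoiding s hom cyc σv γσ≢0 link-faces d≤s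
    where
    link-faces : ∀ {d} → d ≤ s → ∃[ L ] FaceList (link v γ) d L × suc s C d ≤ length L
    link-faces = nonzero-cycle-faces s (link-homogeneous v γ s hom) (link-cycle v γ cyc) {σ ∖ v} (link≢0 v γ σ σv γσ≢0)
  ...   | L₁ , faces₁ , bound₁ | L₂ , faces₂ , bound₂ =
          map (_∪ ⁅ v ⁆) L₁ ++ L₂ , faceList-++ v γ d L₁ L₂ faces₁ faces₂ , count
    where
    open ℕ.≤-Reasoning
    count : suc (suc s) C suc d ≤ length (map (_∪ ⁅ v ⁆) L₁ ++ L₂)
    count = begin
      suc (suc s) C suc d             ≡⟨ nCk+nC[k+1]≡[n+1]C[k+1] (suc s) d ⟨
      suc s C d ℕ.+ suc s C suc d     ≤⟨ ℕ.+-mono-≤ bound₁ bound₂ ⟩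
      length L₁ ℕ.+ length L₂         ≡⟨ cong (ℕ._+ length L₂) (List.length-map (_∪ ⁅ v ⁆) L₁) ⟨
      length (map (_∪ ⁅ v ⁆) L₁) ℕ.+ length L₂ ≡⟨ List.length-++ (map (_∪ ⁅ v ⁆) L₁) ⟨
      length (map (_∪ ⁅ v ⁆) L₁ ++ L₂) ∎

-- Binomial estimates

nCk>0 : ∀ {n k} → k ≤ n → 0 < n C k
nCk>0 {n}     {zero}  _         = s≤s z≤n
nCk>0 {suc n} {suc k} (s≤s k≤n) =
  subst (0 <_) (nCk+nC[k+1]≡[n+1]C[k+1] n k) (ℕ.<-≤-trans (nCk>0 k≤n) (ℕ.m≤m+n (n C k) (n C suc k)))

n≤nCk : ∀ {n k} → 0 < k → k < n → n ≤ n C k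
n≤nCk {suc n} {suc zero}    _ _         = ℕ.≤-reflexive (sym (nC1≡n (suc n)))
n≤nCk {suc n} {suc (suc k)} _ (s≤s k<n) = begin
  suc n                           ≡⟨ ℕ.+-comm 1 n ⟩
  n ℕ.+ 1                         ≤⟨ ℕ.+-mono-≤ (n≤nCk (s≤s z≤n) k<n) (nCk>0 k<n) ⟩
  n C suc k ℕ.+ n C suc (suc k)   ≡⟨ nCk+nC[k+1]≡[n+1]C[k+1] n (suc k) ⟩
  suc n C suc (suc k)             ∎
  where open ℕ.≤-Reasoning

binomial-linear-bound : ∀ e j → (3 ℕ.+ e) ℕ.* suc j ≤ (3 ℕ.+ e ℕ.+ j) C (2 ℕ.+ e)
binomial-linear-bound e zero rewrite ℕ.*-identityʳ (3 ℕ.+ e) | ℕ.+-identityʳ e = n≤nCk (s≤s z≤n) ℕ.≤-refl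
binomial-linear-bound e (suc j) = begin
  (3 ℕ.+ e) ℕ.* suc (suc j)                             ≡⟨ ℕ.*-suc (3 ℕ.+ e) (suc j) ⟩
  3 ℕ.+ e ℕ.+ (3 ℕ.+ e) ℕ.* suc j                       ≤⟨ ℕ.+-mono-≤ outer-column (binomial-linear-bound e j) ⟩
  (3 ℕ.+ e ℕ.+ j) C (1 ℕ.+ e) ℕ.+ (3 ℕ.+ e ℕ.+ j) C (2 ℕ.+ e) ≡⟨ nCk+nC[k+1]≡[n+1]C[k+1] (3 ℕ.+ e ℕ.+ j) (1 ℕ.+ e) ⟩
  suc (3 ℕ.+ e ℕ.+ j) C (2 ℕ.+ e)                       ≡⟨ cong (_C (2 ℕ.+ e)) (ℕ.+-suc (3 ℕ.+ e) j) ⟨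
  (3 ℕ.+ e ℕ.+ suc j) C (2 ℕ.+ e)                       ∎
  where
  open ℕ.≤-Reasoning
  outer-column : 3 ℕ.+ e ≤ (3 ℕ.+ e ℕ.+ j) C (1 ℕ.+ e)
  outer-column = ℕ.≤-trans (ℕ.m≤m+n (3 ℕ.+ e) j)
                   (n≤nCk (s≤s z≤n) (ℕ.≤-trans (ℕ.n≤1+n (2 ℕ.+ e)) (ℕ.m≤m+n (3 ℕ.+ e) j)))

-- Nontrivial cycles in flag complexes

module _ {n : ℕ} where

  cliqueFace-⊆ : ∀ {d} {Γ : SimplicialComplex n} {σ τ} → σ ⊆ₛ τ → CliqueFace d Γ τ → CliqueFace d Γ σ
  cliqueFace-⊆ σ⊆τ τ-clique S S⊆σ ∣S∣ = τ-clique S (Subset.⊆-trans S⊆σ σ⊆τ) ∣S∣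

module Flag {n : ℕ} (Γ : SimplicialComplex n) where

  FaceIn : Subset n → Subset n → Set
  FaceIn W σ = CliqueFace 1 Γ σ × σ ⊆ₛ W

  Adjacent : Fin n → Fin n → Set
  Adjacent v u = ∃ λ τ → CliqueFace 1 Γ τ × lookup τ u ≡ true × lookup τ v ≡ true

  -- Every edge of ρ ∪ {v} lies in ρ or joins v to a vertex of ρ.
  insert-clique : ∀ v ρ → CliqueFace 1 Γ ρ → lookup ρ v ≡ false → (∀ u → lookup ρ u ≡ true → Adjacent v u) →
                  CliqueFace 1 Γ (ρ ∪ ⁅ v ⁆)
  insert-clique v ρ ρ-clique ρv adjacent S S⊆ρ∪v ∣S∣≡2 with lookup S v in Sv
  ... | false = ρ-clique S (λ {x} x∈S → lookup⇒∈ (in-ρ x (∈⇒lookup x∈S))) ∣S∣≡2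
    where
    in-ρ : ∀ x → lookup S x ≡ true → lookup ρ x ≡ true
    in-ρ x Sx with x Fin.≟ v
    ... | yes refl = ⊥-elim (true≢false (trans (sym Sx) Sv))
    ... | no  x≢v  = trans (sym (lookup-insert-other ρ v x x≢v)) (⊆-lookup S⊆ρ∪v x Sx)
  ... | true with ∣p∣≡suc⇒element (S ∖ v) ∣S∖v∣≡1
    where
    ∣S∖v∣≡1 : ∣ S ∖ v ∣ ≡ 1
    ∣S∖v∣≡1 = ℕ.suc-injective (trans (sym (∣p∣≡suc∣p∖x∣ S v Sv)) ∣S∣≡2)
  ...   | u , S∖v∋u with u Fin.≟ v
  ...     | yes refl = ⊥-elim (true≢false (trans (sym S∖v∋u) (lookup-remove-self S u)))
  ...     | no  u≢v with adjacent u (trans (sym (lookup-insert-other ρ v u u≢v))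
                                         (⊆-lookup S⊆ρ∪v u (trans (sym (lookup-remove-other S v u u≢v)) S∖v∋u)))
  ...       | τ , τ-clique , τu , τv = τ-clique S (λ {x} x∈S → lookup⇒∈ (in-τ x (∈⇒lookup x∈S))) ∣S∣≡2
    where
    in-τ : ∀ x → lookup S x ≡ true → lookup τ x ≡ true
    in-τ x Sx with x Fin.≟ v
    ... | yes refl = τv
    ... | no  x≢v  = subst (λ y → lookup τ y ≡ true)
                       (sym (∣p∣≡1⇒element-unique (S ∖ v) u x
                              (ℕ.suc-injective (trans (sym (∣p∣≡suc∣p∖x∣ S v Sv)) ∣S∣≡2)) S∖v∋u
                              (trans (lookup-remove-other S v x x≢v) Sx)))
                       τu

  chain-mono : ∀ {N W} → N ⊆ₛ W → ∀ {k c} → IsChainOf (FaceIn N) k c → IsChainOf (FaceIn W) k c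
  chain-mono N⊆W chain ρ cρ≢0 with chain ρ cρ≢0
  ... | size , clique , ρ⊆N = size , clique , Subset.⊆-trans ρ⊆N N⊆W

  cone-chain : ∀ {N W} v → lookup W v ≡ true → N ⊆ₛ W → (∀ u → lookup N u ≡ true → Adjacent v u) →
               ∀ {m η} → IsChainOf (FaceIn N) m η → IsChainOf (FaceIn W) (suc m) (cone v η)
  cone-chain {N} {W} v Wv N⊆W adjacent {η = η} chain σ coneσ≢0 with cone≢0 v η σ coneσ≢0
  ... | σv , η≢0 with chain (σ ∖ v) η≢0
  ...   | size , clique , σ∖v⊆N =
          trans (∣p∣≡suc∣p∖x∣ σ v σv) (cong suc size) ,
          subst (CliqueFace 1 Γ) (insert-remove σ v σv)
            (insert-clique v (σ ∖ v) clique (lookup-remove-self σ v) (λ u σ∖v∋u → adjacent u (⊆-lookup σ∖v⊆N u σ∖v∋u))) ,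
          λ {x} x∈σ → lookup⇒∈ (in-W x (∈⇒lookup x∈σ))
    where
    in-W : ∀ x → lookup σ x ≡ true → lookup W x ≡ true
    in-W x σx with x Fin.≟ v
    ... | yes refl = Wv
    ... | no  x≢v  = ⊆-lookup N⊆W x (⊆-lookup σ∖v⊆N x (trans (lookup-remove-other σ v x x≢v) σx))

  module LinkAt {W : Subset n} {k} {γ : Chain n} (nontrivial : IsNontrivialCycle (FaceIn W) (suc k) γ)
                {σ v} (γσ≢0 : γ σ ≢ 0ℤ) (σv : lookup σ v ≡ true) where

    private
      chain = proj₁ nontrivial
      cyc = proj₁ (proj₂ nontrivial)
      ¬boundary = proj₂ (proj₂ nontrivial)

    α : Chain n
    α = link v γ

    N : Subset n
    N = vertices α

    W∋v : lookup W v ≡ true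
    W∋v = ⊆-lookup (proj₂ (proj₂ (chain σ γσ≢0))) v σv

    coned-face : ∀ ρ → α ρ ≢ 0ℤ → FaceIn W (ρ ∪ ⁅ v ⁆)
    coned-face ρ αρ≢0 = proj₂ (chain (ρ ∪ ⁅ v ⁆) (link≢0⇒γ≢0 v γ ρ αρ≢0))

    N-adjacent : ∀ u → lookup N u ≡ true → Adjacent v u × u ≢ v
    N-adjacent u Nu with vertices-∈ α u Nu
    ... | ρ , αρ≢0 , ρu =
          (ρ ∪ ⁅ v ⁆ , proj₁ (coned-face ρ αρ≢0) , trans (lookup-insert-other ρ v u u≢v) ρu , lookup-insert-self ρ v) , u≢v
      where
      u≢v : u ≢ v
      u≢v refl = true≢false (trans (sym ρu) (link≢0⇒∌v v γ ρ αρ≢0))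

    N⊆W∖v : N ⊆ₛ W ∖ v
    N⊆W∖v {u} u∈N with N-adjacent u (∈⇒lookup u∈N) | vertices-∈ α u (∈⇒lookup u∈N)
    ... | _ , u≢v | ρ , αρ≢0 , ρu =
          Subset.x∈p∧x≢y⇒x∈p-y (proj₂ (coned-face ρ αρ≢0) (lookup⇒∈ (trans (lookup-insert-other ρ v u u≢v) ρu))) u≢v

    link-chain : IsChainOf (FaceIn N) k α
    link-chain ρ αρ≢0 =
      link-homogeneous v γ (suc k) (λ σ γσ≢0 → proj₁ (chain σ γσ≢0)) ρ αρ≢0 ,
      cliqueFace-⊆ {Γ = Γ} (Subset.p⊆p∪q ⁅ v ⁆) (proj₁ (coned-face ρ αρ≢0)) ,
      λ {u} u∈ρ → lookup⇒∈ (vertices-∋ α ρ u αρ≢0 (∈⇒lookup u∈ρ))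

    cone-chainᴺ : ∀ {m η} → IsChainOf (FaceIn N) m η → IsChainOf (FaceIn W) (suc m) (cone v η)
    cone-chainᴺ = cone-chain v W∋v (Subset.⊆-trans N⊆W∖v (Subset.p─q⊆p W ⁅ v ⁆)) (λ u Nu → proj₁ (N-adjacent u Nu))

    -- A filling β′ of the pushed-off cycle would give the filling β′ - cone v η of γ.
    pushed-off : ∀ η → IsChainOf (FaceIn N) (suc k) η → (∀ τ → ∂ η τ ≡ α τ) →
                 IsNontrivialCycle (FaceIn (W ∖ v)) (suc k) (λ σ → deletion v γ σ + η σ)
    pushed-off η η-chain ∂η≡α = γ′-chain , γ′-cycle , γ′-nontrivial
      where
      γ′ : Chain n
      γ′ σ = deletion v γ σ + η σ
      η∋v≡0 : ∀ σ → lookup σ v ≡ true → η σ ≡ 0ℤ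
      η∋v≡0 σ σv with η σ ℤ.≟ 0ℤ
      ... | yes ησ≡0 = ησ≡0
      ... | no  ησ≢0 = ⊥-elim (proj₂ (N-adjacent v (⊆-lookup (proj₂ (proj₂ (η-chain σ ησ≢0))) v σv)) refl)
      γ′-chain : IsChainOf (FaceIn (W ∖ v)) (suc k) γ′
      γ′-chain σ γ′σ≢0 with x+y≢0 (deletion v γ σ) (η σ) γ′σ≢0
      ... | inj₂ ησ≢0 = chain-mono N⊆W∖v η-chain σ ησ≢0
      ... | inj₁ deletion≢0′ with deletion≢0 v γ σ deletion≢0′
      ...   | σ∌v , γσ≢0 with chain σ γσ≢0
      ...     | size , clique , σ⊆W = size , clique , ⊆-remove v σ⊆W σ∌v
      γ′-cycle : Cycle γ′
      γ′-cycle τ = trans (∂-+ (deletion v γ) η τ)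
                         (trans (cong (_+_ (∂ (deletion v γ) τ)) (∂η≡α τ)) (∂-deletion+link≡0 v γ cyc τ))
      γ′-nontrivial : (β′ : Chain n) → IsChainOf (FaceIn (W ∖ v)) (suc (suc k)) β′ →
                      (∀ τ → ∂ β′ τ ≡ γ′ τ) → Empty
      γ′-nontrivial β′ β′-chain ∂β′≡γ′ = ¬boundary (λ σ → β′ σ - cone v η σ) β-chain ∂β≡γ
        where
        β-chain : IsChainOf (FaceIn W) (suc (suc k)) (λ σ → β′ σ - cone v η σ)
        β-chain σ βσ≢0 with x-y≢0 (β′ σ) (cone v η σ) βσ≢0
        ... | inj₁ β′σ≢0  = chain-mono (Subset.p─q⊆p W ⁅ v ⁆) β′-chain σ β′σ≢0
        ... | inj₂ coneσ≢0 = cone-chainᴺ η-chain σ coneσ≢0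
        ∂β≡γ : ∀ τ → ∂ (λ σ → β′ σ - cone v η σ) τ ≡ γ τ
        ∂β≡γ τ = begin
          ∂ (λ σ → β′ σ - cone v η σ) τ                 ≡⟨ ∂-minus β′ (cone v η) τ ⟩
          ∂ β′ τ - ∂ (cone v η) τ                        ≡⟨ cong₂ _-_ (∂β′≡γ′ τ) (∂-cone v η η∋v≡0 τ) ⟩
          γ′ τ - (η τ - cone v (∂ η) τ)
            ≡⟨ cong (λ c → γ′ τ - (η τ - c)) (cone-cong v (∂ η) α (λ ρ _ → ∂η≡α ρ) τ) ⟩
          deletion v γ τ + η τ - (η τ - cone v α τ)      ≡⟨ cancel (deletion v γ τ) (η τ) (cone v α τ) ⟩
          deletion v γ τ + cone v α τ                    ≡⟨ deletion+cone-link v γ τ ⟨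
          γ τ                                            ∎
          where
          open ≡-Reasoning
          cancel : ∀ r h c → r + h - (h - c) ≡ r + c
          cancel = solve-∀

    -- If every other vertex of W were adjacent to v, γ would bound cone v (deletion v γ).
    outside-neighbour : ∃ λ w → lookup W w ≡ true × w ≢ v × lookup N w ≡ false
    outside-neighbour with Fin.any? (λ w → (lookup W w ≟ true) ×-dec ¬? (w Fin.≟ v) ×-dec (lookup N w ≟ false))
    ... | yes outside = outside
    ... | no  ¬outside = ⊥-elim (¬boundary (cone v (deletion v γ)) (cone-chainᴺ deletion-chain) ∂β≡γ)
      where
      W∖v⊆N : ∀ u → lookup W u ≡ true → u ≢ v → lookup N u ≡ true
      W∖v⊆N u Wu u≢v with lookup N u in Nu
      ... | true  = refl
      ... | false = ⊥-elim (¬outside (u , Wu , u≢v , Nu))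
      deletion-chain : IsChainOf (FaceIn N) (suc k) (deletion v γ)
      deletion-chain σ deletionσ≢0 with deletion≢0 v γ σ deletionσ≢0
      ... | σ∌v , γσ≢0 with chain σ γσ≢0
      ...   | size , clique , σ⊆W = size , clique , λ {u} u∈σ →
              lookup⇒∈ (W∖v⊆N u (⊆-lookup σ⊆W u (∈⇒lookup u∈σ))
                                λ { refl → true≢false (trans (sym (∈⇒lookup u∈σ)) σ∌v) })
      ∂β≡γ : ∀ τ → ∂ (cone v (deletion v γ)) τ ≡ γ τ
      ∂β≡γ τ = begin
        ∂ (cone v (deletion v γ)) τ                     ≡⟨ ∂-cone v (deletion v γ) (deletion-∋v v γ) τ ⟩
        deletion v γ τ - cone v (∂ (deletion v γ)) τ    ≡⟨ cong (_-_ (deletion v γ τ)) cone-∂deletion ⟩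
        deletion v γ τ - - cone v α τ                   ≡⟨ cong (_+_ (deletion v γ τ)) (ℤ.neg-involutive (cone v α τ)) ⟩
        deletion v γ τ + cone v α τ                     ≡⟨ deletion+cone-link v γ τ ⟨
        γ τ                                             ∎
        where
        open ≡-Reasoning
        cone-∂deletion : cone v (∂ (deletion v γ)) τ ≡ - cone v α τ
        cone-∂deletion =
          trans (cone-cong v (∂ (deletion v γ)) (λ ρ → - α ρ) (λ ρ _ → x+y≡0⇒x≡-y (∂-deletion+link≡0 v γ cyc ρ)) τ)
                (cone-neg v α τ)

    2+∣N∣≤∣W∣ : 2 ℕ.+ ∣ N ∣ ≤ ∣ W ∣
    2+∣N∣≤∣W∣ with outside-neighbour
    ... | w , Ww , w≢v , Nw = begin
      2 ℕ.+ ∣ N ∣                 ≤⟨ s≤s (s≤s (Subset.p⊆q⇒∣p∣≤∣q∣ (⊆-remove w N⊆W∖v Nw))) ⟩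
      2 ℕ.+ ∣ W ∖ v ∖ w ∣         ≡⟨ cong suc (∣p∣≡suc∣p∖x∣ (W ∖ v) w (trans (lookup-remove-other W v w w≢v) Ww)) ⟨
      suc ∣ W ∖ v ∣               ≡⟨ ∣p∣≡suc∣p∖x∣ W v W∋v ⟨
      ∣ W ∣                       ∎
      where open ℕ.≤-Reasoning

  zero-cycle-vertices : ∀ {W γ} → IsNontrivialCycle (FaceIn W) 0 γ → 2 ≤ ∣ W ∣
  zero-cycle-vertices {W} {γ} nontrivial@(chain , cyc , _) with nontrivial⇒nonzero nontrivial
  ... | σ , γσ≢0 with ∣p∣≡suc⇒element σ (proj₁ (chain σ γσ≢0))
  ...   | v , σv with cycle-avoids v γ cyc σ σv γσ≢0
  ...     | σ′ , γσ′≢0 , σ′∌v with ∣p∣≡suc⇒element σ′ (proj₁ (chain σ′ γσ′≢0))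
  ...       | w , σ′w = subst (2 ≤_) (sym (∣p∣≡suc∣p∖x∣ W v Wv))
                          (s≤s (element⇒1≤∣p∣ (W ∖ v) w (trans (lookup-remove-other W v w w≢v) Ww)))
    where
    Wv : lookup W v ≡ true
    Wv = ⊆-lookup (proj₂ (proj₂ (chain σ γσ≢0))) v σv
    Ww : lookup W w ≡ true
    Ww = ⊆-lookup (proj₂ (proj₂ (chain σ′ γσ′≢0))) w σ′w
    w≢v : w ≢ v
    w≢v refl = true≢false (trans (sym σ′w) σ′∌v)

  flag-cycle-vertices : ∀ m {W} → ∣ W ∣ < m → ∀ k {γ} → IsNontrivialCycle (FaceIn W) k γ →
                        2 ℕ.+ (k ℕ.+ k) ≤ ∣ W ∣
  flag-cycle-vertices m       W<m      zero    nontrivial = zero-cycle-vertices nontrivial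
  flag-cycle-vertices zero    ()       (suc k) nontrivial
  flag-cycle-vertices (suc m) {W} (s≤s W≤m) (suc k) {γ} nontrivial@(chain , cyc , _) with nontrivial⇒nonzero nontrivial
  ... | σ , γσ≢0 with ∣p∣≡suc⇒element σ (proj₁ (chain σ γσ≢0))
  ...   | v , σv with 2 ℕ.+ (suc k ℕ.+ suc k) ≤? ∣ W ∣
  ...     | yes bound = bound
  ...     | no ¬bound = ⊥-elim (¬bound (begin
    2 ℕ.+ (suc k ℕ.+ suc k)   ≡⟨ cong (2 ℕ.+_) (ℕ.+-suc (suc k) k) ⟩
    4 ℕ.+ (k ℕ.+ k)           ≤⟨ s≤s (s≤s link-bound) ⟩
    2 ℕ.+ ∣ N ∣               ≤⟨ 2+∣N∣≤∣W∣ ⟩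
    ∣ W ∣                     ∎))
    where
    open ℕ.≤-Reasoning
    open LinkAt nontrivial γσ≢0 σv
    ∣W∖v∣<m : ∣ W ∖ v ∣ < m
    ∣W∖v∣<m = ℕ.<-≤-trans (Subset.x∈p⇒∣p-x∣<∣p∣ {p = W} (lookup⇒∈ W∋v)) W≤m
    link-nontrivial : IsNontrivialCycle (FaceIn N) k α
    link-nontrivial = link-chain , link-cycle v γ cyc , λ η η-chain ∂η≡α →
      ¬bound (ℕ.≤-trans (flag-cycle-vertices m ∣W∖v∣<m (suc k) (pushed-off η η-chain ∂η≡α))
                        (Subset.p⊆q⇒∣p∣≤∣q∣ (Subset.p─q⊆p W ⁅ v ⁆)))
    link-bound : 2 ℕ.+ (k ℕ.+ k) ≤ ∣ N ∣
    link-bound = flag-cycle-vertices m (ℕ.≤-<-trans (Subset.p⊆q⇒∣p∣≤∣q∣ N⊆W∖v) ∣W∖v∣<m) k link-nontrivial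

elements : ∀ {n} → Subset n → List (Fin n)
elements []          = List.[]
elements (true  ∷ p) = zero List.∷ map suc (elements p)
elements (false ∷ p) = map suc (elements p)

elements-length : ∀ {n} (p : Subset n) → length (elements p) ≡ ∣ p ∣
elements-length []          = refl
elements-length (true  ∷ p) = cong suc (trans (List.length-map suc (elements p)) (elements-length p))
elements-length (false ∷ p) = trans (List.length-map suc (elements p)) (elements-length p)

elements-∈ : ∀ {n} (p : Subset n) → All (λ u → lookup p u ≡ true) (elements p)
elements-∈ []          = All.[]
elements-∈ (true  ∷ p) = refl All.∷ All.map⁺ (elements-∈ p)
elements-∈ (false ∷ p) = All.map⁺ (elements-∈ p)

elements-unique : ∀ {n} (p : Subset n) → Unique (elements p)
elements-unique []          = AllPairs.[]
elements-unique (true  ∷ p) = All.map⁺ (All.tabulate (λ _ ())) AllPairs.∷ Unique.map⁺ Fin.suc-injective (elements-unique p)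
elements-unique (false ∷ p) = Unique.map⁺ Fin.suc-injective (elements-unique p)

vertex-faceList : ∀ {n} (γ : Chain n) → FaceList γ 1 (map ⁅_⁆ (elements (vertices γ)))
vertex-faceList γ =
  Unique.map⁺ ⁅⁆-injective (elements-unique (vertices γ)) ,
  All.map⁺ (All.map (λ {u} → vertex-face u) (elements-∈ (vertices γ)))
  where
  ⁅⁆-injective : ∀ {x y} → ⁅ x ⁆ ≡ ⁅ y ⁆ → x ≡ y
  ⁅⁆-injective {x} {y} ⁅x⁆≡⁅y⁆ = Subset.x∈⁅y⁆⇒x≡y y (subst (x ∈ₛ_) ⁅x⁆≡⁅y⁆ (Subset.x∈⁅x⁆ x))
  vertex-face : ∀ u → lookup (vertices γ) u ≡ true → SuppClosureFace γ ⁅ u ⁆ × ∣ ⁅ u ⁆ ∣ ≡ 1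
  vertex-face u u∈ with vertices-∈ γ u u∈
  ... | ρ , γρ≢0 , ρu =
        (ρ , γρ≢0 , λ {x} x∈⁅u⁆ → subst (_∈ₛ ρ) (sym (Subset.x∈⁅y⁆⇒x≡y u x∈⁅u⁆)) (lookup⇒∈ ρu)) ,
        Subset.∣⁅x⁆∣≡1 u

nontrivial-on-vertices : ∀ {n} (Γ : SimplicialComplex n) {k γ} → IsNontrivialCycle (CliqueFace 1 Γ) k γ →
                         IsNontrivialCycle (Flag.FaceIn Γ (vertices γ)) k γ
nontrivial-on-vertices Γ {γ = γ} (chain , cyc , ¬boundary) =
  (λ σ γσ≢0 → proj₁ (chain σ γσ≢0) , proj₂ (chain σ γσ≢0) ,
               λ {u} u∈σ → lookup⇒∈ (vertices-∋ γ σ u γσ≢0 (∈⇒lookup u∈σ))) ,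
  cyc ,
  λ β β-chain ∂β≡γ → ¬boundary β (λ σ βσ≢0 → proj₁ (β-chain σ βσ≢0) , proj₁ (proj₂ (β-chain σ βσ≢0))) ∂β≡γ

faceList⇒hasAtLeast : ∀ {n} {γ : Chain n} {s L m} → FaceList γ s L → m ℤ.≤ + length L →
                      HasAtLeastFacesOfSize (SuppClosureFace γ) s m
faceList⇒hasAtLeast (unique , faces) bound = _ , unique , faces , bound

faceBound : ℕ → ℕ → ℤ
faceBound d k = (+ (suc d)) * (+ k - + d + + 1) + + d + + 1

faceBound-flag : ∀ k → faceBound 1 k ≡ + (2 ℕ.+ (k ℕ.+ k))
faceBound-flag k = trans (identity (+ k)) (cong (_+_ (+ 2)) (sym (ℤ.pos-+ k k)))
  where
  identity : ∀ K → (+ 2) * (K - + 1 + + 1) + + 1 + + 1 ≡ + 2 + (K + K)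
  identity = solve-∀

faceBound-nonpositive : ∀ k j → faceBound (2 ℕ.+ (k ℕ.+ j)) k ℤ.≤ 0ℤ
faceBound-nonpositive k j = subst (ℤ._≤ 0ℤ) (sym value) ℤ.neg-≤-pos
  where
  identity : ∀ K J → (+ 3 + K + J) * (K - (+ 2 + K + J) + + 1) + (+ 2 + K + J) + + 1 ≡ - ((+ 3 + K + J) * J)
  identity = solve-∀
  value : faceBound (2 ℕ.+ (k ℕ.+ j)) k ≡ - (+ ((3 ℕ.+ k ℕ.+ j) ℕ.* j))
  value = trans (cong (λ D → (+ 1 + D) * (+ k - D + + 1) + D + + 1) (ℤ.pos-+ (2 ℕ.+ k) j))
                (trans (identity (+ k) (+ j))
                       (cong -_ (sym (trans (ℤ.pos-* (3 ℕ.+ k ℕ.+ j) j) (cong (_* + j) (ℤ.pos-+ (3 ℕ.+ k) j))))))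

faceBound-binomial : ∀ e j → faceBound (2 ℕ.+ e) (suc e ℕ.+ j) ≡ + ((3 ℕ.+ e) ℕ.* suc j)
faceBound-binomial e j =
  trans (cong (λ K → (+ 3 + + e) * (K - (+ 2 + + e) + + 1) + (+ 2 + + e) + + 1) (ℤ.pos-+ (suc e) j))
        (trans (identity (+ e) (+ j)) (sym (ℤ.pos-* (3 ℕ.+ e) (suc j))))
  where
  identity : ∀ E J → (+ 3 + E) * ((+ 1 + E + J) - (+ 2 + E) + + 1) + (+ 2 + E) + + 1 ≡ (+ 3 + E) * (+ 1 + J)
  identity = solve-∀

flag-cycle-faces : ∀ {n} (Γ : SimplicialComplex n) {k γ} → IsNontrivialCycle (CliqueFace 1 Γ) k γ →
                   HasAtLeastFacesOfSize (SuppClosureFace γ) 1 (faceBound 1 k)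
flag-cycle-faces Γ {k} {γ} nontrivial =
  faceList⇒hasAtLeast (vertex-faceList γ) $
  subst (ℤ._≤ + length (map ⁅_⁆ (elements (vertices γ)))) (sym (faceBound-flag k)) $
  ℤ.+≤+ $
  subst (2 ℕ.+ (k ℕ.+ k) ≤_) (sym (trans (List.length-map ⁅_⁆ (elements (vertices γ))) (elements-length (vertices γ)))) $
  Flag.flag-cycle-vertices Γ (suc ∣ vertices γ ∣) ℕ.≤-refl k (nontrivial-on-vertices Γ nontrivial)

cycle-faces : ∀ e j {n} {P : Subset n → Set} {γ} → IsNontrivialCycle P (suc e ℕ.+ j) γ →
              HasAtLeastFacesOfSize (SuppClosureFace γ) (2 ℕ.+ e) (faceBound (2 ℕ.+ e) (suc e ℕ.+ j))
cycle-faces e j {γ = γ} nontrivial@(chain , cyc , _) =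
  conclude (nonzero-cycle-faces _ (λ σ γσ≢0 → proj₁ (chain σ γσ≢0)) cyc (proj₂ (nontrivial⇒nonzero nontrivial))
                                (s≤s (s≤s (ℕ.m≤m+n e j))))
  where
  conclude : ∃[ L ] FaceList γ (2 ℕ.+ e) L × (3 ℕ.+ e ℕ.+ j) C (2 ℕ.+ e) ≤ length L →
             HasAtLeastFacesOfSize (SuppClosureFace γ) (2 ℕ.+ e) (faceBound (2 ℕ.+ e) (suc e ℕ.+ j))
  conclude (L , faces , bound) =
    faceList⇒hasAtLeast faces $ subst (ℤ._≤ + length L) (sym (faceBound-binomial e j)) $
    ℤ.+≤+ (ℕ.≤-trans (binomial-linear-bound e j) bound)

lemma3p4 : (d k n : ℕ) → d ≥ 1 → (Γ : SimplicialComplex n) → (γ : Chain n)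
    → IsNontrivialCycle (CliqueFace d Γ) k γ
    → HasAtLeastFacesOfSize (SuppClosureFace γ) d
        ((+ (suc d)) * (+ k - + d + + 1) + + d + + 1)
lemma3p4 zero          k n () Γ γ nontrivial
lemma3p4 1             k n _  Γ γ nontrivial = flag-cycle-faces Γ nontrivial
lemma3p4 (suc (suc e)) k n _  Γ γ nontrivial with k ≤? e
... | yes k≤e with ℕ.m≤n⇒∃[o]m+o≡n k≤e
...   | j , refl = List.[] , AllPairs.[] , All.[] , faceBound-nonpositive k j
lemma3p4 (suc (suc e)) k n _  Γ γ nontrivial | no k≰e with ℕ.m≤n⇒∃[o]m+o≡n (ℕ.≰⇒> k≰e)
...   | j , refl = cycle-faces e j nontrivial
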